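{- Let $n\ge5$ and let $G$ be the $n\times n$ toroidal chess graph. Let $v$ be any vertex and let $a,b$ be any two vertices, where $a$ and $b$ are the positions of two cops moving as knights. Then at least one of the five vertices $v,\ v\pm(1,0),\ v\pm(0,1)$ is protected by neither cop.
   Context: The $n\times n$ toroidal chess graph has vertex set $\mathbb{Z}_n\times\mathbb{Z}_n$, where $(i,j)$ is row $i$, column $j$, with coordinates taken mod $n$. Two vertices are adjacent if they differ by $\pm1$ in exactly one coordinate and agree in the other. A cop moving as a knight at vertex $(i,j)$ protects exactly its allowable vertices, namely the knight-move vertices $(i\pm1,j\pm2)$ and $(i\pm2,j\pm1)$ (all sign choices, mod $n$). -}

module Defs where

open import Data.Nat using (ℕ; NonZero)
open import Data.Integer using (ℤ; +_; -_; _+_)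
open import Data.Integer.DivMod using (_%ℕ_; n%ℕd<d)
open import Data.Fin using (Fin; toℕ; fromℕ<)
open import Data.Product using (_×_; _,_; ∃)
open import Data.Sum using (_⊎_)
open import Data.List using (List; _∷_; [])
open import Data.List.Membership.Propositional using (_∈_)
open import Relation.Binary.PropositionalEquality using (_≡_)
open import Relation.Nullary using (¬_)

-- ℤ_n is represented by Fin n (canonical residues 0 … n-1).
-- Adding an integer offset d to a residue i, reduced mod n.
shift : (n : ℕ) → .{{_ : NonZero n}} → Fin n → ℤ → Fin n
shift n i d = fromℕ< (n%ℕd<d (+ toℕ i + d) n)

Vertex : ℕ → Set
Vertex n = Fin n × Fin n

translate : (n : ℕ) → .{{_ : NonZero n}} → Vertex n → ℤ × ℤ → Vertex n
translate n (i , j) (di , dj) = shift n i di , shift n j dj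

knightMoves : List (ℤ × ℤ)
knightMoves =
  (+ 1 , + 2) ∷ (+ 1 , - + 2) ∷ (- + 1 , + 2) ∷ (- + 1 , - + 2) ∷
  (+ 2 , + 1) ∷ (+ 2 , - + 1) ∷ (- + 2 , + 1) ∷ (- + 2 , - + 1) ∷ []

KnightProtects : (n : ℕ) → .{{_ : NonZero n}} → Vertex n → Vertex n → Set
KnightProtects n c w = ∃ λ d → d ∈ knightMoves × translate n c d ≡ w

closedNbhdMoves : List (ℤ × ℤ)
closedNbhdMoves =
  (+ 0 , + 0) ∷ (+ 1 , + 0) ∷ (- + 1 , + 0) ∷ (+ 0 , + 1) ∷ (+ 0 , - + 1) ∷ []

module Submission where

-- A knight cop protects at most two of the five vertices v, v ± (1,0), v ± (0,1)
-- when n ≥ 5; two cops therefore protect at most four of them, and one is left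
-- unprotected.
--
-- Why at most two: if a cop at c protects v + d through the knight move k, then
-- c + k ≡ v + d (mod n) in both coordinates, so the "apparent displacement"
-- k - d is congruent to v - c.  Two protections by the same cop thus give
-- congruent apparent displacements.  A finite computation shows that for any
-- three of the five offsets and any three knight moves, two of the three
-- apparent displacements differ in some coordinate by 1, 2, 3 or 4 — and such
-- integers are not divisible by n ≥ 5.

open import Defs
open import Data.Nat as ℕ using (ℕ; suc; _≤_; _<_; _≤?_; _<?_; NonZero; s≤s)
import Data.Nat.Properties as ℕ
open import Data.Nat.Divisibility using (>⇒∤)
open import Data.Integer using (ℤ; +_; _+_; _-_; _*_; ∣_∣)
open import Data.Integer.DivMod using (_%ℕ_; _/ℕ_; n%ℕd<d; a≡a%ℕn+[a/ℕn]*n)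
open import Data.Integer.Divisibility.Signed using (_∣_; divides; ∣m∣n⇒∣m-n; ∣⇒∣ᵤ)
open import Data.Integer.Tactic.RingSolver using (solve-∀)
open import Data.Fin using (toℕ; _≟_)
open import Data.Fin.Properties using (toℕ-fromℕ<)
open import Data.Product using (_×_; _,_; ∃; proj₁; proj₂)
open import Data.Product.Properties using (≡-dec)
open import Data.Sum using (_⊎_; inj₁; inj₂)
open import Data.Unit using (⊤; tt)
open import Data.Empty using (⊥; ⊥-elim)
open import Data.List using (List; []; _∷_; filter; length)
open import Data.List.Membership.Propositional using (_∈_; find; lose)
open import Data.List.Relation.Unary.Any using (here; there; any?)
open import Data.List.Relation.Unary.All as All using (All; []; _∷_; all?)
open import Data.List.Relation.Unary.All.Properties using (all-filter)
open import Data.List.Relation.Unary.AllPairs using (AllPairs; _∷_; allPairs?)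
open import Data.List.Relation.Binary.Sublist.Propositional
  using (_⊆_; _∷_; _∷ʳ_; ⊆-trans; minimum; lookup)
open import Data.List.Relation.Binary.Sublist.Propositional.Properties using (filter-⊆)
open import Relation.Nullary using (¬_; Dec; yes; no)
open import Relation.Nullary.Decidable using (_×-dec_; _⊎-dec_; map′; toWitness)
open import Relation.Unary using (Pred; Decidable)
open import Level using (0ℓ)
open import Relation.Binary.PropositionalEquality

module _ {A : Set} where

  AllTriples : (A → A → A → Set) → List A → Set
  AllTriples R []       = ⊤
  AllTriples R (x ∷ xs) = AllPairs (R x) xs × AllTriples R xs

  allTriples? : {R : A → A → A → Set} → (∀ x y z → Dec (R x y z)) →
    (xs : List A) → Dec (AllTriples R xs)
  allTriples? R? []       = yes tt
  allTriples? R? (x ∷ xs) = allPairs? (R? x) xs ×-dec allTriples? R? xs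

  allPairs-⊆ : {R : A → A → Set} {xs : List A} {y z : A} →
    AllPairs R xs → (y ∷ z ∷ []) ⊆ xs → R y z
  allPairs-⊆ (_ ∷ rs) (_ ∷ʳ τ)   = allPairs-⊆ rs τ
  allPairs-⊆ (r ∷ _)  (refl ∷ τ) = All.lookup r (lookup τ (here refl))

  allTriples-⊆ : {R : A → A → A → Set} {xs : List A} {x y z : A} →
    AllTriples R xs → (x ∷ y ∷ z ∷ []) ⊆ xs → R x y z
  allTriples-⊆ (_ , rs) (_ ∷ʳ τ)   = allTriples-⊆ rs τ
  allTriples-⊆ (r , _)  (refl ∷ τ) = allPairs-⊆ r τ

  threeSatisfying : {P : Pred A 0ℓ} (P? : Decidable P) (xs : List A) →
    3 ≤ length (filter P? xs) →
    ∃ λ x → ∃ λ y → ∃ λ z → (x ∷ y ∷ z ∷ []) ⊆ xs × P x × P y × P z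
  threeSatisfying P? xs = firstThree (all-filter P? xs) (filter-⊆ P? xs)
    where
    firstThree : ∀ {P ys} → All P ys → ys ⊆ xs → 3 ≤ length ys →
      ∃ λ x → ∃ λ y → ∃ λ z → (x ∷ y ∷ z ∷ []) ⊆ xs × P x × P y × P z
    firstThree (px ∷ py ∷ pz ∷ ps) τ _ =
      _ , _ , _ , ⊆-trans (refl ∷ refl ∷ refl ∷ minimum _) τ , px , py , pz
    firstThree []                    _ ()
    firstThree (_ ∷ [])              _ (s≤s ())
    firstThree (_ ∷ _ ∷ [])          _ (s≤s (s≤s ()))

  inTail : {P : Pred A 0ℓ} {x : A} {xs : List A} →
    (∃ λ y → y ∈ xs × P y) → ∃ λ y → y ∈ x ∷ xs × P y
  inTail (y , y∈xs , py) = y , there y∈xs , py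

  neitherSatisfied : {P Q : Pred A 0ℓ} (P? : Decidable P) (Q? : Decidable Q) (xs : List A) →
    length (filter P? xs) ℕ.+ length (filter Q? xs) < length xs →
    ∃ λ x → x ∈ xs × ¬ P x × ¬ Q x
  neitherSatisfied P? Q? (x ∷ xs) lt with P? x | Q? x
  ... | no ¬p | no ¬q = x , here refl , ¬p , ¬q
  ... | yes _ | no _  = inTail (neitherSatisfied P? Q? xs (ℕ.s≤s⁻¹ lt))
  ... | no _  | yes _ =
    inTail (neitherSatisfied P? Q? xs (subst (_≤ length xs) (ℕ.+-suc _ _) (ℕ.s≤s⁻¹ lt)))
  ... | yes _ | yes _ =
    inTail (neitherSatisfied P? Q? xs (ℕ.≤-trans (ℕ.+-monoʳ-≤ (suc _) (ℕ.n≤1+n _)) (ℕ.s≤s⁻¹ lt)))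

ℤ² : Set
ℤ² = ℤ × ℤ

_⊕_ : ℤ² → ℤ² → ℤ²
(a , b) ⊕ (c , d) = (a + c , b + d)

_⊖_ : ℤ² → ℤ² → ℤ²
(a , b) ⊖ (c , d) = (a - c , b - d)

lift : {n : ℕ} → Vertex n → ℤ²
lift (i , j) = + toℕ i , + toℕ j

Congruent : ℕ → ℤ² → ℤ² → Set
Congruent n (a , b) (c , d) = (+ n ∣ a - c) × (+ n ∣ b - d)

%ℕ-≡⇒∣ : (n : ℕ) .{{_ : NonZero n}} (a b : ℤ) → a %ℕ n ≡ b %ℕ n → + n ∣ a - b
%ℕ-≡⇒∣ n a b eq = divides (a /ℕ n - b /ℕ n) (begin
    a - b
      ≡⟨ cong₂ _-_ (a≡a%ℕn+[a/ℕn]*n a n) (a≡a%ℕn+[a/ℕn]*n b n) ⟩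
    (+ (a %ℕ n) + (a /ℕ n) * + n) - (+ (b %ℕ n) + (b /ℕ n) * + n)
      ≡⟨ cong (λ r → (+ r + (a /ℕ n) * + n) - (+ (b %ℕ n) + (b /ℕ n) * + n)) eq ⟩
    (+ (b %ℕ n) + (a /ℕ n) * + n) - (+ (b %ℕ n) + (b /ℕ n) * + n)
      ≡⟨ cancelResidue (+ (b %ℕ n)) (a /ℕ n) (b /ℕ n) (+ n) ⟩
    (a /ℕ n - b /ℕ n) * + n ∎)
  where
  open ≡-Reasoning
  cancelResidue : ∀ r p q m → (r + p * m) - (r + q * m) ≡ (p - q) * m
  cancelResidue = solve-∀

translate-≡⇒congruent : (n : ℕ) .{{_ : NonZero n}} (x y : Vertex n) (d e : ℤ²) →
  translate n x d ≡ translate n y e → Congruent n (lift x ⊕ d) (lift y ⊕ e)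
translate-≡⇒congruent n (i , j) (k , l) (d₁ , d₂) (e₁ , e₂) eq =
  shift-≡⇒∣ i k d₁ e₁ (cong proj₁ eq) , shift-≡⇒∣ j l d₂ e₂ (cong proj₂ eq)
  where
  shift-≡⇒∣ : ∀ i k d e → shift n i d ≡ shift n k e → + n ∣ (+ toℕ i + d) - (+ toℕ k + e)
  shift-≡⇒∣ i k d e eq = %ℕ-≡⇒∣ n (+ toℕ i + d) (+ toℕ k + e) (begin
      (+ toℕ i + d) %ℕ n        ≡⟨ toℕ-fromℕ< (n%ℕd<d (+ toℕ i + d) n) ⟨
      toℕ (shift n i d)         ≡⟨ cong toℕ eq ⟩
      toℕ (shift n k e)         ≡⟨ toℕ-fromℕ< (n%ℕd<d (+ toℕ k + e) n) ⟩
      (+ toℕ k + e) %ℕ n        ∎)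
    where open ≡-Reasoning

congruent-displacements : (n : ℕ) (X Y k d k′ d′ : ℤ²) →
  Congruent n (X ⊕ k) (Y ⊕ d) → Congruent n (X ⊕ k′) (Y ⊕ d′) →
  Congruent n (k ⊖ d) (k′ ⊖ d′)
congruent-displacements n (X₁ , X₂) (Y₁ , Y₂) (k₁ , k₂) (d₁ , d₂) (k₁′ , k₂′) (d₁′ , d₂′)
  (p₁ , p₂) (q₁ , q₂) = coordinate X₁ Y₁ k₁ d₁ k₁′ d₁′ p₁ q₁ , coordinate X₂ Y₂ k₂ d₂ k₂′ d₂′ p₂ q₂
  where
  coordinate : ∀ X Y k d k′ d′ → + n ∣ (X + k) - (Y + d) → + n ∣ (X + k′) - (Y + d′) →
    + n ∣ (k - d) - (k′ - d′)
  coordinate X Y k d k′ d′ p q = subst (+ n ∣_) (regroup X Y k d k′ d′) (∣m∣n⇒∣m-n p q)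
    where
    regroup : ∀ X Y k d k′ d′ → ((X + k) - (Y + d)) - ((X + k′) - (Y + d′)) ≡ (k - d) - (k′ - d′)
    regroup = solve-∀

small-∤ : (n : ℕ) (z : ℤ) → 0 < ∣ z ∣ → ∣ z ∣ < n → ¬ (+ n ∣ z)
small-∤ n z pos lt n∣z = >⇒∤ {{ℕ.>-nonZero pos}} lt (∣⇒∣ᵤ n∣z)

-- An integer of absolute value 1, 2, 3 or 4; by small-∤ never divisible by n ≥ 5.
Small : ℤ → Set
Small z = 0 < ∣ z ∣ × ∣ z ∣ < 5

Apart : ℤ² → ℤ² → Set
Apart (a , b) (c , d) = Small (a - c) ⊎ Small (b - d)

apart⇒incongruent : (n : ℕ) → 5 ≤ n → (u w : ℤ²) → Apart u w → ¬ Congruent n u w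
apart⇒incongruent n 5≤n (a , b) (c , d) (inj₁ (pos , lt)) (n∣ , _) =
  small-∤ n (a - c) pos (ℕ.<-≤-trans lt 5≤n) n∣
apart⇒incongruent n 5≤n (a , b) (c , d) (inj₂ (pos , lt)) (_ , n∣) =
  small-∤ n (b - d) pos (ℕ.<-≤-trans lt 5≤n) n∣

apart? : (u w : ℤ²) → Dec (Apart u w)
apart? (a , b) (c , d) = small? (a - c) ⊎-dec small? (b - d)
  where
  small? : (z : ℤ) → Dec (Small z)
  small? z = (0 <? ∣ z ∣) ×-dec (∣ z ∣ <? 5)

Spread : ℤ² → ℤ² → ℤ² → Set
Spread x y z =
  All (λ k → All (λ k′ → All (λ k″ →
    Apart (k ⊖ x) (k′ ⊖ y) ⊎ Apart (k ⊖ x) (k″ ⊖ z) ⊎ Apart (k′ ⊖ y) (k″ ⊖ z))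
  knightMoves) knightMoves) knightMoves

spread? : (x y z : ℤ²) → Dec (Spread x y z)
spread? x y z =
  all? (λ k → all? (λ k′ → all? (λ k″ →
    apart? (k ⊖ x) (k′ ⊖ y) ⊎-dec apart? (k ⊖ x) (k″ ⊖ z) ⊎-dec apart? (k′ ⊖ y) (k″ ⊖ z))
  knightMoves) knightMoves) knightMoves

closedNbhd-spread : AllTriples Spread closedNbhdMoves
closedNbhd-spread = toWitness {a? = allTriples? spread? closedNbhdMoves} tt

module _ (n : ℕ) .{{_ : NonZero n}} where

  Protects : Vertex n → Vertex n → ℤ² → Set
  Protects c v d = KnightProtects n c (translate n v d)

  protects? : (c v : Vertex n) → Decidable (Protects c v)
  protects? c v d = map′ find (λ (k , k∈ , eq) → lose k∈ eq)
    (any? (λ k → ≡-dec _≟_ _≟_ (translate n c k) (translate n v d)) knightMoves)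

  protection-congruence : (c v : Vertex n) (d : ℤ²) → Protects c v d →
    ∃ λ k → k ∈ knightMoves × Congruent n (lift c ⊕ k) (lift v ⊕ d)
  protection-congruence c v d (k , k∈ , eq) = k , k∈ , translate-≡⇒congruent n c v k d eq

  sameCop : (c v : Vertex n) (k d k′ d′ : ℤ²) → Congruent n (lift c ⊕ k) (lift v ⊕ d) →
    Congruent n (lift c ⊕ k′) (lift v ⊕ d′) → Congruent n (k ⊖ d) (k′ ⊖ d′)
  sameCop c v = congruent-displacements n (lift c) (lift v)

  spread-notAllProtected : 5 ≤ n → (c v : Vertex n) {x y z : ℤ²} → Spread x y z →
    Protects c v x → Protects c v y → Protects c v z → ⊥
  spread-notAllProtected 5≤n c v {x} {y} {z} spread px py pz
    with protection-congruence c v x px | protection-congruence c v y py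
       | protection-congruence c v z pz
  ... | k , k∈ , cx | k′ , k′∈ , cy | k″ , k″∈ , cz
    with All.lookup (All.lookup (All.lookup spread k∈) k′∈) k″∈
  ... | inj₁ xy        = apart⇒incongruent n 5≤n (k ⊖ x) (k′ ⊖ y) xy (sameCop c v k x k′ y cx cy)
  ... | inj₂ (inj₁ xz) = apart⇒incongruent n 5≤n (k ⊖ x) (k″ ⊖ z) xz (sameCop c v k x k″ z cx cz)
  ... | inj₂ (inj₂ yz) = apart⇒incongruent n 5≤n (k′ ⊖ y) (k″ ⊖ z) yz (sameCop c v k′ y k″ z cy cz)

  atMostTwoProtected : 5 ≤ n → (c v : Vertex n) →
    length (filter (protects? c v) closedNbhdMoves) ≤ 2
  atMostTwoProtected 5≤n c v with length (filter (protects? c v) closedNbhdMoves) ≤? 2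
  ... | yes ≤2 = ≤2
  ... | no ≰2 with threeSatisfying (protects? c v) closedNbhdMoves (ℕ.≰⇒> ≰2)
  ... | x , y , z , τ , px , py , pz =
    ⊥-elim (spread-notAllProtected 5≤n c v (allTriples-⊆ {R = Spread} closedNbhd-spread τ) px py pz)

-- Each cop protects at most two of the five vertices, and 2 + 2 < 5.
lemma1 : (n : ℕ) .{{_ : NonZero n}} → 5 ≤ n → (v a b : Vertex n) →
    ∃ λ (d : ℤ × ℤ) → d ∈ closedNbhdMoves ×
    ¬ KnightProtects n a (translate n v d) × ¬ KnightProtects n b (translate n v d)
lemma1 n 5≤n v a b =
  neitherSatisfied (protects? n a v) (protects? n b v) closedNbhdMoves
    (s≤s (ℕ.+-mono-≤ (atMostTwoProtected n 5≤n a v) (atMostTwoProtected n 5≤n b v)))
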